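{- Let $G=(V,E)$ be an undirected simple graph, $\ell$ a positive integer and $v\in V$; let $G_v=G[N[v]]$. (i) Let $S_v$ be the vertex set of the graph obtained from $G_v$ by exhaustively applying the vertex version of the Low-Triangle Rule. Then $S_v$ is a largest vertex-$\ell$-triangle 2-club contained in $G_v$. (ii) Let $S_v$ be the vertex set of the graph obtained from $G_v$ by exhaustively applying the edge version of the Low-Triangle Rule. Then $S_v$ is a largest edge-$\ell$-triangle 2-club contained in $G_v$.
   Context: $N[v]$ is the closed neighborhood of $v$ (its neighbors together with $v$), and $G[X]$ is the subgraph induced by $X$. A triangle is a set of three pairwise adjacent vertices. The Low-Triangle Rule: (vertex version) delete all vertices that are contained in fewer than $\ell$ triangles of the current graph; (edge version) delete all edges contained in fewer than $\ell$ triangles of the current graph and delete isolated vertices; exhaustive application means repeating until nothing changes. A set $S$ of vertices of a graph $H$ is a vertex-$\ell$-triangle 2-club in $H$ if $H[S]$ has diameter at most $2$ and every vertex of $S$ is in at least $\ell$ triangles of $H[S]$. $S$ is an edge-$\ell$-triangle 2-club in $H$ if there is a spanning subgraph $(S,\widehat E)$ of $H[S]$ that has diameter at most $2$ and in which every edge of $\widehat E$ is contained in at least $\ell$ triangles of $(S,\widehat E)$. -}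

module Defs where

open import Data.Nat using (ℕ; zero; suc; _≤_; _≤ᵇ_; _<ᵇ_)
open import Data.Bool using (Bool; true; false; T; _∧_; _∨_; if_then_else_)
open import Data.Fin using (Fin; toℕ; _≟_)
open import Data.Fin.Subset using (Subset; _∈_; _⊆_; ∣_∣)
open import Data.Vec using (lookup; tabulate)
open import Data.List using (map; allFin)
open import Data.Nat.ListAction using (sum)
open import Data.Bool.ListAction using (any)
open import Data.Product using (Σ; ∃; _×_; _,_; proj₁; proj₂)
open import Data.Sum using (_⊎_)
open import Relation.Nullary.Decidable using (⌊_⌋)
open import Relation.Binary.PropositionalEquality using (_≡_)

record Graph (n : ℕ) : Set where
  field
    adj        : Fin n → Fin n → Bool
    adj-sym    : ∀ u w → adj u w ≡ adj w u
    adj-irrefl : ∀ u → adj u u ≡ false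
open Graph public

EdgeSet : ℕ → Set
EdgeSet n = Fin n → Fin n → Bool

sumF : ∀ {n} → (Fin n → ℕ) → ℕ
sumF {n} f = sum (map f (allFin n))

ind : Bool → ℕ
ind b = if b then 1 else 0

closedNbhd : ∀ {n} → Graph n → Fin n → Subset n
closedNbhd G v = tabulate (λ u → ⌊ u ≟ v ⌋ ∨ adj G v u)

induced : ∀ {n} → Graph n → Subset n → EdgeSet n
induced G S u w = adj G u w ∧ lookup S u ∧ lookup S w

-- Number of triangles of the graph (S , E) containing vertex v
-- (unordered pairs {u,w}, counted once via toℕ u < toℕ w).
triV : ∀ {n} → Subset n → EdgeSet n → Fin n → ℕ
triV S E v = sumF λ u → sumF λ w →
  ind ((toℕ u <ᵇ toℕ w) ∧ lookup S v ∧ lookup S u ∧ lookup S w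
       ∧ E v u ∧ E v w ∧ E u w)

triE : ∀ {n} → Subset n → EdgeSet n → Fin n → Fin n → ℕ
triE S E u w = sumF λ x → ind (lookup S x ∧ E u x ∧ E w x)

Diam≤2 : ∀ {n} → Subset n → EdgeSet n → Set
Diam≤2 S E = ∀ u w → u ∈ S → w ∈ S →
  u ≡ w ⊎ T (E u w) ⊎ ∃ λ x → x ∈ S × T (E u x) × T (E x w)

-- X is a vertex-ℓ-triangle 2-club contained in G_v = G[N[v]].
-- (For X ⊆ N[v], G_v[X] = G[X].)
VClub : ∀ {n} → Graph n → ℕ → Fin n → Subset n → Set
VClub G ℓ v X = X ⊆ closedNbhd G v
              × Diam≤2 X (induced G X)
              × (∀ u → u ∈ X → ℓ ≤ triV X (induced G X) u)

EClub : ∀ {n} → Graph n → ℕ → Fin n → Subset n → Set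
EClub {n} G ℓ v X = X ⊆ closedNbhd G v
  × Σ (EdgeSet n) λ Ê →
      (∀ u w → Ê u w ≡ Ê w u)
    × (∀ u w → T (Ê u w) → T (induced G X u w))
    × Diam≤2 X Ê
    × (∀ u w → T (Ê u w) → ℓ ≤ triE X Ê u w)

iter : ∀ {A : Set} → (A → A) → ℕ → A → A
iter f zero    a = a
iter f (suc k) a = f (iter f k a)

stepV : ∀ {n} → Graph n → ℕ → Subset n → Subset n
stepV G ℓ S = tabulate λ u → lookup S u ∧ (ℓ ≤ᵇ triV S (induced G S) u)

ResultV : ∀ {n} → Graph n → ℕ → Fin n → Subset n → Set
ResultV G ℓ v S = Σ ℕ λ k →
  iter (stepV G ℓ) k (closedNbhd G v) ≡ S × stepV G ℓ S ≡ S

EState : ℕ → Set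
EState n = Subset n × EdgeSet n

_≈ₛ_ : ∀ {n} → EState n → EState n → Set
(S , F) ≈ₛ (S' , F') = S ≡ S' × (∀ u w → F u w ≡ F' u w)

stepE : ∀ {n} → ℕ → EState n → EState n
stepE {n} ℓ (S , F) = S' , F'
  where
  F' : EdgeSet n
  F' u w = F u w ∧ (ℓ ≤ᵇ triE S F u w)
  S' : Subset n
  S' = tabulate λ u → lookup S u ∧ any (λ w → F' u w) (allFin n)

initE : ∀ {n} → Graph n → Fin n → EState n
initE G v = closedNbhd G v , induced G (closedNbhd G v)

ResultE : ∀ {n} → Graph n → ℕ → Fin n → Subset n → Set
ResultE G ℓ v S = Σ ℕ λ k →
  proj₁ (iter (stepE ℓ) k (initE G v)) ≡ S
  × stepE ℓ (iter (stepE ℓ) k (initE G v)) ≈ₛ iter (stepE ℓ) k (initE G v)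

-- Every vertex of G_v other than v is adjacent to v. So for S ⊆ N[v] with v ∈ S the
-- transposition (u v) maps the triangles of G[S] through u injectively to triangles through
-- v, and (for an edge set containing all spokes {v,x}) the transposition (v w) maps the
-- triangles on an edge {u,w}, w ≠ v, to triangles on the spoke {v,u}. Hence the rules
-- delete neither v nor a spoke while anything incident to them survives, and every remainder
-- has diameter at most 2 through v. Both rules are monotone, so a club X inside G_v, whose
-- vertices (edges) already lie in ℓ triangles within X, survives every round and is contained
-- in the result; in the edge version this needs |X| ≥ 2, so that no vertex of X is isolated.

module Submission where

open import Data.Bool using (Bool; true; false; T; _∧_; _∨_)
open import Data.Bool.ListAction using (any)
open import Data.Bool.Properties using (T-∧; T-∨; T-≡; ∧-comm)
open import Data.Empty using (⊥-elim)
open import Data.Fin using (Fin; zero; suc; toℕ; _≟_)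
open import Data.Fin.Permutation using (Permutation; _⟨$⟩ʳ_; transpose)
import Data.Fin.Permutation.Components as PC
open import Data.Fin.Properties using (toℕ-injective; any?)
open import Data.Fin.Subset using (Subset; _∈_; _⊆_; ∣_∣; ⁅_⁆)
open import Data.Fin.Subset.Properties
  using (_∈?_; ⊆-antisym; p⊂q⇒∣p∣<∣q∣; p⊆q⇒∣p∣≤∣q∣; ∣⁅x⁆∣≡1; x∈⁅x⁆)
open import Data.List using (tabulate; allFin)
open import Data.List.Membership.Propositional using (lose)
open import Data.List.Membership.Propositional.Properties using (∈-allFin)
open import Data.List.Properties using (map-tabulate)
open import Data.List.Relation.Unary.Any using (satisfied)
open import Data.List.Relation.Unary.Any.Properties using (any⇔)
open import Data.Nat using (ℕ; zero; suc; _+_; _*_; _≤_; _<_; _<ᵇ_; _≤ᵇ_; z≤n; s≤s)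
open import Data.Nat.ListAction using () renaming (sum to listSum)
open import Data.Nat.Properties
  using (+-0-commutativeMonoid; +-mono-≤; +-mono-<-≤; +-mono-≤-<; m≤n⇒m<n∨m≡n; +-identityʳ;
         <-irrefl; <-asym; ≮⇒≥; ≤-antisym; <ᵇ-reflects-<; n≮0; <-≤-trans; ≤-pred; ≤-refl; ≤-trans; ≤-reflexive;
         *-cancelˡ-≤; ≤ᵇ⇒≤; ≤⇒≤ᵇ; module ≤-Reasoning)
open import Algebra.Properties.CommutativeMonoid.Sum +-0-commutativeMonoid
  using (sum; sum-cong-≗; ∑-comm; ∑-distrib-+; sum-permute)
open import Data.Product using (Σ; ∃-syntax; _×_; _,_; proj₁; proj₂)
open import Data.Sum using (_⊎_; inj₁; inj₂)
import Data.Sum as Sum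
open import Data.Vec using (lookup) renaming (tabulate to tabulateᵛ)
open import Data.Vec.Properties using (lookup∘tabulate; []=⇒lookup; lookup⇒[]=)
open import Function using (_∘_; _⇔_; mk⇔; Equivalence)
open import Relation.Nullary using (¬_; Dec; yes; no; contradiction)
open import Relation.Nullary.Decidable
  using (dec-true; dec-false; decidable-stable; _×-dec_; ¬?; toWitness; fromWitness)
open import Relation.Nullary.Reflects using (ofʸ; ofⁿ)
open import Relation.Binary.PropositionalEquality
  using (_≡_; _≢_; refl; sym; trans; cong; cong₂; subst; module ≡-Reasoning)

open import Defs

open Equivalence using (to; from)

T-∧³ : ∀ {x y z} → T (x ∧ y ∧ z) ⇔ (T x × T y × T z)
T-∧³ {true}  {true}  {true}  = mk⇔ _ _
T-∧³ {true}  {true}  {false} = mk⇔ (λ ()) λ ()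
T-∧³ {true}  {false}         = mk⇔ (λ ()) λ ()
T-∧³ {false}                 = mk⇔ (λ ()) λ ()

T-injective : ∀ {a b} → (T a → T b) → (T b → T a) → a ≡ b
T-injective {false} {false} _ _ = refl
T-injective {true}  {true}  _ _ = refl
T-injective {false} {true}  _ b⇒a = ⊥-elim (b⇒a _)
T-injective {true}  {false} a⇒b _ = ⊥-elim (a⇒b _)

T-any-allFin⇔ : ∀ {n} {p : Fin n → Bool} → T (any p (allFin n)) ⇔ (∃[ w ] T (p w))
T-any-allFin⇔ {n} {p} = mk⇔ (satisfied ∘ from (any⇔ {xs = allFin n} {p}))
                              (λ (w , pw) → to (any⇔ {xs = allFin n} {p}) (lose (∈-allFin w) pw))

ind-mono : ∀ {a b} → (T a → T b) → ind a ≤ ind b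
ind-mono {false}          _ = z≤n
ind-mono {true}  {true}   _ = ≤-refl
ind-mono {true}  {false} a⇒b = ⊥-elim (a⇒b _)

ind-injective : ∀ {a b} → ind a ≡ ind b → a ≡ b
ind-injective {false} {false} _ = refl
ind-injective {true}  {true}  _ = refl

sum-tabulate : ∀ {n} (f : Fin n → ℕ) → listSum (tabulate f) ≡ sum f
sum-tabulate {zero}  f = refl
sum-tabulate {suc n} f = cong (f zero +_) (sum-tabulate (f ∘ suc))

sumF≡sum : ∀ {n} (f : Fin n → ℕ) → sumF f ≡ sum f
sumF≡sum {n} f = trans (cong listSum (map-tabulate {n = n} (λ i → i) f)) (sum-tabulate f)

sum₂ : ∀ {n} → (Fin n → Fin n → ℕ) → ℕ
sum₂ f = sum λ a → sum (f a)

sumF₂≡sum₂ : ∀ {n} (f : Fin n → Fin n → ℕ) → sumF (λ a → sumF (f a)) ≡ sum₂ f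
sumF₂≡sum₂ f = trans (sumF≡sum (λ a → sumF (f a))) (sum-cong-≗ λ a → sumF≡sum (f a))

sum-mono-≤ : ∀ {n} {f g : Fin n → ℕ} → (∀ i → f i ≤ g i) → sum f ≤ sum g
sum-mono-≤ {zero}  _   = z≤n
sum-mono-≤ {suc n} f≤g = +-mono-≤ (f≤g zero) (sum-mono-≤ (f≤g ∘ suc))

sum-mono-≤⇒≗⊎< : ∀ {n} {f g : Fin n → ℕ} → (∀ i → f i ≤ g i) →
                 (∀ i → f i ≡ g i) ⊎ sum f < sum g
sum-mono-≤⇒≗⊎< {zero}  _ = inj₁ λ ()
sum-mono-≤⇒≗⊎< {suc n} f≤g
  with m≤n⇒m<n∨m≡n (f≤g zero) | sum-mono-≤⇒≗⊎< (f≤g ∘ suc)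
... | inj₁ f₀<g₀ | _          = inj₂ (+-mono-<-≤ f₀<g₀ (sum-mono-≤ (f≤g ∘ suc)))
... | inj₂ _     | inj₂ rest< = inj₂ (+-mono-≤-< (f≤g zero) rest<)
... | inj₂ f₀≡g₀ | inj₁ rest≗ = inj₁ λ { zero → f₀≡g₀ ; (suc i) → rest≗ i }

sum₂-mono-≤⇒≗⊎< : ∀ {n} {f g : Fin n → Fin n → ℕ} → (∀ a b → f a b ≤ g a b) →
                  (∀ a b → f a b ≡ g a b) ⊎ sum₂ f < sum₂ g
sum₂-mono-≤⇒≗⊎< {f = f} {g} f≤g with sum-mono-≤⇒≗⊎< (λ a → sum-mono-≤ (f≤g a))
... | inj₂ sum< = inj₂ sum<
... | inj₁ rows≡ = inj₁ row≡
  where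
  row≡ : ∀ a b → f a b ≡ g a b
  row≡ a with sum-mono-≤⇒≗⊎< (f≤g a)
  ... | inj₁ row≗ = row≗
  ... | inj₂ row< = contradiction (rows≡ a) (λ eq → <-irrefl eq row<)

sum₂-permute : ∀ {n} (π : Permutation n n) (f : Fin n → Fin n → ℕ) →
               sum₂ f ≡ sum₂ (λ a b → f (π ⟨$⟩ʳ a) (π ⟨$⟩ʳ b))
sum₂-permute π f = trans (sum-permute (λ a → sum (f a)) π)
                         (sum-cong-≗ (λ a → sum-permute (f (π ⟨$⟩ʳ a)) π))

module _ {n} (R : Fin n → Fin n → Bool)
         (R-sym : ∀ a b → R a b ≡ R b a) (R-irrefl : ∀ a → R a a ≡ false) where

  private
    R< : Fin n → Fin n → ℕ
    R< a b = ind ((toℕ a <ᵇ toℕ b) ∧ R a b)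

    ind-R≡R<+R> : ∀ a b → ind (R a b) ≡ R< a b + R< b a
    ind-R≡R<+R> a b
      with toℕ a <ᵇ toℕ b | <ᵇ-reflects-< (toℕ a) (toℕ b)
         | toℕ b <ᵇ toℕ a | <ᵇ-reflects-< (toℕ b) (toℕ a)
    ... | true  | ofʸ a<b | true  | ofʸ b<a = contradiction b<a (<-asym a<b)
    ... | true  | _       | false | _       = sym (+-identityʳ _)
    ... | false | _       | true  | _       = cong ind (R-sym a b)
    ... | false | ofⁿ a≮b | false | ofⁿ b≮a
      rewrite toℕ-injective (≤-antisym (≮⇒≥ b≮a) (≮⇒≥ a≮b)) = cong ind (R-irrefl b)

  sum₂-ordered≡2*sum₂-increasing :
    sum₂ (λ a b → ind (R a b)) ≡ 2 * sum₂ (λ a b → ind ((toℕ a <ᵇ toℕ b) ∧ R a b))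
  sum₂-ordered≡2*sum₂-increasing = begin
    sum₂ (λ a b → ind (R a b))                  ≡⟨ sum-cong-≗ (λ a → sum-cong-≗ (ind-R≡R<+R> a)) ⟩
    sum (λ a → sum (λ b → R< a b + R< b a))      ≡⟨ sum-cong-≗ (λ a → ∑-distrib-+ (R< a) (λ b → R< b a)) ⟩
    sum (λ a → sum (R< a) + sum (λ b → R< b a))  ≡⟨ ∑-distrib-+ (λ a → sum (R< a)) _ ⟩
    sum₂ R< + sum (λ a → sum (λ b → R< b a))     ≡⟨ cong (sum₂ R< +_) (∑-comm R<) ⟨
    sum₂ R< + sum₂ R<                            ≡⟨ cong (sum₂ R< +_) (+-identityʳ _) ⟨
    2 * sum₂ R<                                  ∎
    where open ≡-Reasoning

transpose-matchˡ : ∀ {n} (i j : Fin n) → PC.transpose i j i ≡ j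
transpose-matchˡ i j rewrite dec-true (i ≟ i) refl = refl

transpose-matchʳ : ∀ {n} (i j : Fin n) → PC.transpose i j j ≡ i
transpose-matchʳ i j with j ≟ i
... | yes j≡i = j≡i
... | no j≢i rewrite dec-true (j ≟ j) refl = refl

transpose-other : ∀ {n} {i j k : Fin n} → k ≢ i → k ≢ j → PC.transpose i j k ≡ k
transpose-other {i = i} {j} {k} k≢i k≢j
  rewrite dec-false (k ≟ i) k≢i | dec-false (k ≟ j) k≢j = refl

∈⇔T-lookup : ∀ {n} {x : Fin n} {p : Subset n} → x ∈ p ⇔ T (lookup p x)
∈⇔T-lookup {x = x} {p} = mk⇔ (from T-≡ ∘ []=⇒lookup) (lookup⇒[]= x p ∘ to T-≡)

∈-tabulate⇔ : ∀ {n} {x : Fin n} {f : Fin n → Bool} → x ∈ tabulateᵛ f ⇔ T (f x)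
∈-tabulate⇔ {x = x} {f} =
  mk⇔ (subst T (lookup∘tabulate f x) ∘ to ∈⇔T-lookup)
      (from ∈⇔T-lookup ∘ subst T (sym (lookup∘tabulate f x)))

⊆⇒≡⊎∣∣< : ∀ {n} {p q : Subset n} → p ⊆ q → p ≡ q ⊎ ∣ p ∣ < ∣ q ∣
⊆⇒≡⊎∣∣< {p = p} {q} p⊆q with any? (λ x → x ∈? q ×-dec ¬? (x ∈? p))
... | yes q∖p-nonempty = inj₂ (p⊂q⇒∣p∣<∣q∣ (p⊆q , q∖p-nonempty))
... | no  q∖p-empty    = inj₁ (⊆-antisym p⊆q q⊆p)
  where
  q⊆p : q ⊆ p
  q⊆p {x} x∈q = decidable-stable (x ∈? p) (λ x∉p → q∖p-empty (x , x∈q , x∉p))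

2≤∣p∣⇒∃other : ∀ {n} {p : Subset n} {x} → 2 ≤ ∣ p ∣ → x ∈ p → ∃[ y ] y ∈ p × y ≢ x
2≤∣p∣⇒∃other {p = p} {x} 2≤∣p∣ x∈p with any? (λ y → y ∈? p ×-dec ¬? (y ≟ x))
... | yes other = other
... | no  none  =
  contradiction (≤-trans 2≤∣p∣ (≤-trans (p⊆q⇒∣p∣≤∣q∣ p⊆⁅x⁆) (≤-reflexive (∣⁅x⁆∣≡1 x)))) λ { (s≤s ()) }
  where
  p⊆⁅x⁆ : p ⊆ ⁅ x ⁆
  p⊆⁅x⁆ {y} y∈p with y ≟ x
  ... | yes refl = x∈⁅x⁆ x
  ... | no  y≢x  = contradiction (y , y∈p , y≢x) none

module _ {A : Set} (f : A → A) (Fixed : A → Set) (μ : A → ℕ)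
         (progress : ∀ a → Fixed a ⊎ μ (f a) < μ a) where

  iter-reaches-fixed : ∀ a → ∃[ k ] Fixed (iter f k a)
  iter-reaches-fixed a = search (μ a) 0 ≤-refl
    where
    search : ∀ bound k → μ (iter f k a) ≤ bound → ∃[ k ] Fixed (iter f k a)
    search bound k μ≤bound with progress (iter f k a)
    ... | inj₁ fixed = k , fixed
    search zero        k μ≤0       | inj₂ μ< = contradiction (<-≤-trans μ< μ≤0) n≮0
    search (suc bound) k μ≤1+bound | inj₂ μ< =
      search bound (suc k) (≤-pred (<-≤-trans μ< μ≤1+bound))

star⇒diam≤2 : ∀ {n} {S : Subset n} {F : EdgeSet n} (v : Fin n) →
              (∀ u w → F u w ≡ F w u) → (∀ {x} → x ∈ S → v ∈ S) →
              (∀ {x} → x ∈ S → x ≢ v → T (F v x)) → Diam≤2 S F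
star⇒diam≤2 v F-sym centre star u w u∈S w∈S with u ≟ w | u ≟ v | w ≟ v
... | yes u≡w | _        | _        = inj₁ u≡w
... | no u≢w  | yes refl | _        = inj₂ (inj₁ (star w∈S (u≢w ∘ sym)))
... | no _    | no u≢v   | yes refl = inj₂ (inj₁ (subst T (F-sym w u) (star u∈S u≢v)))
... | no _    | no u≢v   | no w≢v   =
  inj₂ (inj₂ (v , centre u∈S , subst T (F-sym v u) (star u∈S u≢v) , star w∈S w≢v))

diam≤2⇒∃neighbour : ∀ {n} {S : Subset n} {F : EdgeSet n} → Diam≤2 S F → 2 ≤ ∣ S ∣ →
                    ∀ {u} → u ∈ S → ∃[ w ] T (F u w)
diam≤2⇒∃neighbour diam 2≤∣S∣ u∈S with 2≤∣p∣⇒∃other 2≤∣S∣ u∈S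
... | w , w∈S , w≢u with diam _ w u∈S w∈S
...   | inj₁ u≡w                 = contradiction (sym u≡w) w≢u
...   | inj₂ (inj₁ uw)           = w , uw
...   | inj₂ (inj₂ (x , _ , ux , _)) = x , ux

module _ {n : ℕ} where

  _⊑_ : EState n → EState n → Set
  (X , Ê) ⊑ (S , F) = X ⊆ S × (∀ {p q} → T (Ê p q) → T (F p q))

  commonNbr⇔ : ∀ {S : Subset n} {F : EdgeSet n} {u w x} →
               T (lookup S x ∧ F u x ∧ F w x) ⇔ (x ∈ S × T (F u x) × T (F w x))
  commonNbr⇔ {S = S} {F = F} {u} {w} {x} = mk⇔
    (λ t → let (x∈S , ux , wx) = to (T-∧³ {lookup S x} {F u x}) t
           in from ∈⇔T-lookup x∈S , ux , wx)
    (λ (x∈S , ux , wx) → from (T-∧³ {lookup S x} {F u x}) (to ∈⇔T-lookup x∈S , ux , wx))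

  triE≡sum : ∀ (S : Subset n) (F : EdgeSet n) u w →
             triE S F u w ≡ sum (λ x → ind (lookup S x ∧ F u x ∧ F w x))
  triE≡sum S F u w = sumF≡sum λ x → ind (lookup S x ∧ F u x ∧ F w x)

  triE-sym : ∀ (S : Subset n) (F : EdgeSet n) u w → triE S F u w ≡ triE S F w u
  triE-sym S F u w = begin
    triE S F u w                                 ≡⟨ triE≡sum S F u w ⟩
    sum (λ x → ind (lookup S x ∧ F u x ∧ F w x))
      ≡⟨ sum-cong-≗ (λ x → cong (ind ∘ (lookup S x ∧_)) (∧-comm (F u x) (F w x))) ⟩
    sum (λ x → ind (lookup S x ∧ F w x ∧ F u x))  ≡⟨ triE≡sum S F w u ⟨
    triE S F w u                                 ∎
    where open ≡-Reasoning

  triE-mono-≤ : ∀ {X S : Subset n} {Ê F : EdgeSet n} → (X , Ê) ⊑ (S , F) →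
                ∀ u w → triE X Ê u w ≤ triE S F u w
  triE-mono-≤ {X} {S} {Ê} {F} (X⊆S , Ê⊆F) u w = begin
    triE X Ê u w                                 ≡⟨ triE≡sum X Ê u w ⟩
    sum (λ x → ind (lookup X x ∧ Ê u x ∧ Ê w x))  ≤⟨ sum-mono-≤ (ind-mono ∘ enlarge) ⟩
    sum (λ x → ind (lookup S x ∧ F u x ∧ F w x))  ≡⟨ triE≡sum S F u w ⟨
    triE S F u w                                 ∎
    where
    open ≤-Reasoning
    enlarge : ∀ x → T (lookup X x ∧ Ê u x ∧ Ê w x) → T (lookup S x ∧ F u x ∧ F w x)
    enlarge x t = let (x∈X , ux , wx) = to (commonNbr⇔ {S = X} {F = Ê}) t
                  in from (commonNbr⇔ {S = S} {F = F}) (X⊆S x∈X , Ê⊆F ux , Ê⊆F wx)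

module _ {n} (G : Graph n) where

  adj⇒≢ : ∀ {u w} → T (adj G u w) → u ≢ w
  adj⇒≢ {u} uw refl = subst T (adj-irrefl G u) uw

  ∈closedNbhd⇔ : ∀ {v x} → x ∈ closedNbhd G v ⇔ (x ≡ v ⊎ T (adj G v x))
  ∈closedNbhd⇔ {v} {x} = mk⇔
    (Sum.map₁ (toWitness {a? = x ≟ v}) ∘ to T-∨ ∘ to ∈-tabulate⇔)
    (from ∈-tabulate⇔ ∘ from T-∨ ∘ Sum.map₁ (fromWitness {a? = x ≟ v}))

  v∈closedNbhd : ∀ v → v ∈ closedNbhd G v
  v∈closedNbhd v = from ∈closedNbhd⇔ (inj₁ refl)

  closedNbhd⇒adj : ∀ {v x} → x ∈ closedNbhd G v → x ≢ v → T (adj G v x)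
  closedNbhd⇒adj x∈N x≢v with to ∈closedNbhd⇔ x∈N
  ... | inj₁ x≡v = contradiction x≡v x≢v
  ... | inj₂ vx  = vx

  induced⇔ : ∀ {S u w} → T (induced G S u w) ⇔ (T (adj G u w) × u ∈ S × w ∈ S)
  induced⇔ = mk⇔
    (λ e → let (uw , u∈S , w∈S) = to T-∧³ e
           in uw , from ∈⇔T-lookup u∈S , from ∈⇔T-lookup w∈S)
    (λ (uw , u∈S , w∈S) → from T-∧³ (uw , to ∈⇔T-lookup u∈S , to ∈⇔T-lookup w∈S))

  induced-sym : ∀ S u w → induced G S u w ≡ induced G S w u
  induced-sym S u w = cong₂ _∧_ (adj-sym G u w) (∧-comm (lookup S u) (lookup S w))

  induced-irrefl : ∀ {S u} → ¬ T (induced G S u u)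
  induced-irrefl {S} e = adj⇒≢ (proj₁ (to (induced⇔ {S}) e)) refl

  induced-mono : ∀ {X S u w} → X ⊆ S → T (induced G X u w) → T (induced G S u w)
  induced-mono {X} {S} X⊆S e =
    let (uw , u∈X , w∈X) = to (induced⇔ {X}) e
    in from (induced⇔ {S}) (uw , X⊆S u∈X , X⊆S w∈X)

  isTriangle : Subset n → Fin n → Fin n → Fin n → Bool
  isTriangle S x a b = lookup S x ∧ lookup S a ∧ lookup S b
                     ∧ induced G S x a ∧ induced G S x b ∧ induced G S a b

  isTriangle⇔ : ∀ S x a b →
    T (isTriangle S x a b) ⇔ (T (induced G S x a) × T (induced G S x b) × T (induced G S a b))
  isTriangle⇔ S x a b = mk⇔ edges triangle
    where
    edges : T (isTriangle S x a b) →
            T (induced G S x a) × T (induced G S x b) × T (induced G S a b)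
    edges t = let (_ , _ , t₁) = to (T-∧³ {lookup S x} {lookup S a}) t
                  (_ , xa , t₂) = to (T-∧³ {lookup S b} {induced G S x a}) t₁
              in xa , to T-∧ t₂
    triangle : T (induced G S x a) × T (induced G S x b) × T (induced G S a b) →
               T (isTriangle S x a b)
    triangle (xa , xb , ab) =
      let (_ , x∈S , a∈S) = to (induced⇔ {S}) xa ; (_ , _ , b∈S) = to (induced⇔ {S}) xb
      in from T-∧³ (to ∈⇔T-lookup x∈S , to ∈⇔T-lookup a∈S ,
                    from T-∧³ (to ∈⇔T-lookup b∈S , xa , from T-∧ (xb , ab)))

  isTriangle-sym : ∀ S x a b → isTriangle S x a b ≡ isTriangle S x b a
  isTriangle-sym S x a b = T-injective (swap a b) (swap b a)
    where
    swap : ∀ a b → T (isTriangle S x a b) → T (isTriangle S x b a)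
    swap a b t = let (xa , xb , ab) = to (isTriangle⇔ S x a b) t
                 in from (isTriangle⇔ S x b a) (xb , xa , subst T (induced-sym S a b) ab)

  isTriangle-irrefl : ∀ S x a → isTriangle S x a a ≡ false
  isTriangle-irrefl S x a =
    T-injective (λ t → induced-irrefl {S} (proj₂ (proj₂ (to (isTriangle⇔ S x a a) t)))) λ ()

  -- triV counts a triangle {x,a,b} once, as the pair a < b; transpositions of vertices do not
  -- preserve that order, so comparisons go through the count of ordered pairs.
  2*triV≡sum₂-isTriangle : ∀ S x →
    2 * triV S (induced G S) x ≡ sum₂ (λ a b → ind (isTriangle S x a b))
  2*triV≡sum₂-isTriangle S x = begin
    2 * triV S (induced G S) x
      ≡⟨ cong (2 *_) (sumF₂≡sum₂ λ a b → ind ((toℕ a <ᵇ toℕ b) ∧ isTriangle S x a b)) ⟩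
    2 * sum₂ (λ a b → ind ((toℕ a <ᵇ toℕ b) ∧ isTriangle S x a b))
      ≡⟨ sum₂-ordered≡2*sum₂-increasing
           (isTriangle S x) (isTriangle-sym S x) (isTriangle-irrefl S x) ⟨
    sum₂ (λ a b → ind (isTriangle S x a b)) ∎
    where open ≡-Reasoning

  triV-mono-≤ : ∀ {X S} → X ⊆ S → ∀ x → triV X (induced G X) x ≤ triV S (induced G S) x
  triV-mono-≤ {X} {S} X⊆S x = *-cancelˡ-≤ 2 (begin
    2 * triV X (induced G X) x              ≡⟨ 2*triV≡sum₂-isTriangle X x ⟩
    sum₂ (λ a b → ind (isTriangle X x a b)) ≤⟨ sum-mono-≤ (λ a → sum-mono-≤ (ind-mono ∘ enlarge a)) ⟩
    sum₂ (λ a b → ind (isTriangle S x a b)) ≡⟨ 2*triV≡sum₂-isTriangle S x ⟨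
    2 * triV S (induced G S) x              ∎)
    where
    open ≤-Reasoning
    enlarge : ∀ a b → T (isTriangle X x a b) → T (isTriangle S x a b)
    enlarge a b t =
      let (xa , xb , ab) = to (isTriangle⇔ X x a b) t
      in from (isTriangle⇔ S x a b) (induced-mono X⊆S xa , induced-mono X⊆S xb , induced-mono X⊆S ab)

  module _ {S : Subset n} {v : Fin n} (S⊆N[v] : S ⊆ closedNbhd G v) (v∈S : v ∈ S) (u : Fin n)
    where

    private
      σ : Fin n → Fin n
      σ = PC.transpose u v

      neighbour≢u : ∀ {c} → T (induced G S u c) → c ≢ u
      neighbour≢u uc = adj⇒≢ (proj₁ (to (induced⇔ {S}) uc)) ∘ sym

    transpose-neighbour : ∀ {c} → T (induced G S u c) → T (induced G S v (σ c))
    transpose-neighbour {c} uc with c ≟ v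
    ... | yes refl rewrite transpose-matchʳ u v = subst T (induced-sym S u v) uc
    ... | no c≢v =
      let (_ , _ , c∈S) = to (induced⇔ {S}) uc
      in subst (λ y → T (induced G S v y)) (sym (transpose-other (neighbour≢u uc) c≢v))
               (from (induced⇔ {S}) (closedNbhd⇒adj (S⊆N[v] c∈S) c≢v , v∈S , c∈S))

    transpose-edge : ∀ {a b} → T (induced G S u a) → T (induced G S u b) →
                     T (induced G S a b) → T (induced G S (σ a) (σ b))
    transpose-edge {a} {b} ua ub ab with a ≟ v | b ≟ v
    ... | yes refl | yes refl = contradiction ab (induced-irrefl {S})
    ... | yes refl | no b≢v
      rewrite transpose-matchʳ u v | transpose-other (neighbour≢u ub) b≢v = ub
    ... | no a≢v   | yes refl
      rewrite transpose-matchʳ u v | transpose-other (neighbour≢u ua) a≢v =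
        subst T (induced-sym S u a) ua
    ... | no a≢v   | no b≢v
      rewrite transpose-other (neighbour≢u ua) a≢v | transpose-other (neighbour≢u ub) b≢v = ab

    isTriangle-transpose : ∀ a b → T (isTriangle S u a b) → T (isTriangle S v (σ a) (σ b))
    isTriangle-transpose a b t =
      let (ua , ub , ab) = to (isTriangle⇔ S u a b) t
      in from (isTriangle⇔ S v (σ a) (σ b))
              (transpose-neighbour ua , transpose-neighbour ub , transpose-edge ua ub ab)

    triV≤triV-centre : triV S (induced G S) u ≤ triV S (induced G S) v
    triV≤triV-centre = *-cancelˡ-≤ 2 (begin
      2 * triV S (induced G S) u                      ≡⟨ 2*triV≡sum₂-isTriangle S u ⟩
      sum₂ (λ a b → ind (isTriangle S u a b))
        ≤⟨ sum-mono-≤ (λ a → sum-mono-≤ (ind-mono ∘ isTriangle-transpose a)) ⟩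
      sum₂ (λ a b → ind (isTriangle S v (σ a) (σ b))) ≡⟨ sum₂-permute (transpose u v) _ ⟨
      sum₂ (λ a b → ind (isTriangle S v a b))         ≡⟨ 2*triV≡sum₂-isTriangle S v ⟨
      2 * triV S (induced G S) v                      ∎)
      where open ≤-Reasoning

  module _ (ℓ : ℕ) (v : Fin n) where

    ∈stepV⇔ : ∀ {S u} → u ∈ stepV G ℓ S ⇔ (u ∈ S × ℓ ≤ triV S (induced G S) u)
    ∈stepV⇔ = mk⇔
      (λ t → let (u∈S , enough) = to T-∧ (to ∈-tabulate⇔ t)
             in from ∈⇔T-lookup u∈S , ≤ᵇ⇒≤ ℓ _ enough)
      (λ (u∈S , enough) → from ∈-tabulate⇔ (from T-∧ (to ∈⇔T-lookup u∈S , ≤⇒≤ᵇ enough)))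

    stepV-⊆ : ∀ S → stepV G ℓ S ⊆ S
    stepV-⊆ S = proj₁ ∘ to ∈stepV⇔

    record Centred (S : Subset n) : Set where
      field
        ⊆closedNbhd : S ⊆ closedNbhd G v
        centre∈     : ∀ {u} → u ∈ S → v ∈ S
    open Centred

    stepV-centred : ∀ {S} → Centred S → Centred (stepV G ℓ S)
    stepV-centred {S} c = record
      { ⊆closedNbhd = ⊆closedNbhd c ∘ stepV-⊆ S
      ; centre∈     = λ {u} u∈S′ →
          let (u∈S , enough) = to ∈stepV⇔ u∈S′ ; v∈S = centre∈ c u∈S
          in from ∈stepV⇔ (v∈S , ≤-trans enough (triV≤triV-centre {S} (⊆closedNbhd c) v∈S u))
      }

    iterV : ℕ → Subset n
    iterV k = iter (stepV G ℓ) k (closedNbhd G v)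

    iterV-centred : ∀ k → Centred (iterV k)
    iterV-centred zero    = record { ⊆closedNbhd = λ u∈N → u∈N
                                   ; centre∈     = λ _ → v∈closedNbhd v }
    iterV-centred (suc k) = stepV-centred (iterV-centred k)

    ResultV-exists : Σ (Subset n) (ResultV G ℓ v)
    ResultV-exists =
      let (k , fixed) = iter-reaches-fixed (stepV G ℓ) (λ S → stepV G ℓ S ≡ S) ∣_∣
                          (λ S → ⊆⇒≡⊎∣∣< (stepV-⊆ S)) (closedNbhd G v)
      in iterV k , k , refl , fixed

    centred-fixed⇒VClub : ∀ {S} → Centred S → stepV G ℓ S ≡ S → VClub G ℓ v S
    centred-fixed⇒VClub {S} c fixed =
        ⊆closedNbhd c
      , star⇒diam≤2 v (induced-sym S) (centre∈ c) star
      , λ u u∈S → proj₂ (to (∈stepV⇔ {S}) (subst (u ∈_) (sym fixed) u∈S))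
      where
      star : ∀ {x} → x ∈ S → x ≢ v → T (induced G S v x)
      star x∈S x≢v =
        from (induced⇔ {S}) (closedNbhd⇒adj (⊆closedNbhd c x∈S) x≢v , centre∈ c x∈S , x∈S)

    VClub⊆iterV : ∀ {X} → VClub G ℓ v X → ∀ k → X ⊆ iterV k
    VClub⊆iterV (X⊆N , _)             zero    = X⊆N
    VClub⊆iterV club@(_ , _ , enough) (suc k) {u} u∈X =
      from ∈stepV⇔ (VClub⊆iterV club k u∈X , ≤-trans (enough u u∈X) (triV-mono-≤ (VClub⊆iterV club k) u))

    ResultV⇒largest-VClub : ∀ {S} → ResultV G ℓ v S →
      VClub G ℓ v S × (∀ X → VClub G ℓ v X → ∣ X ∣ ≤ ∣ S ∣)
    ResultV⇒largest-VClub (k , refl , fixed) =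
      centred-fixed⇒VClub (iterV-centred k) fixed , λ X club → p⊆q⇒∣p∣≤∣q∣ (VClub⊆iterV club k)

    record EdgeInvariant (S : Subset n) (F : EdgeSet n) : Set where
      field
        F-sym       : ∀ u w → F u w ≡ F w u
        F⊆induced   : ∀ {u w} → T (F u w) → T (induced G S u w)
        ⊆closedNbhd : S ⊆ closedNbhd G v
        star        : ∀ {x} → x ∈ S → x ≢ v → T (F v x)
    open EdgeInvariant

    triE≤triE-star : ∀ {S : Subset n} {F : EdgeSet n} → EdgeInvariant S F →
                     ∀ {u w} → T (F u w) → w ≢ v → triE S F u w ≤ triE S F v u
    triE≤triE-star {S} {F} I {u} {w} uw w≢v = begin
      triE S F u w                                             ≡⟨ triE≡sum S F u w ⟩
      sum (λ x → ind (lookup S x ∧ F u x ∧ F w x))             ≤⟨ sum-mono-≤ (ind-mono ∘ move) ⟩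
      sum (λ x → ind (lookup S (σ x) ∧ F v (σ x) ∧ F u (σ x))) ≡⟨ sum-permute _ (transpose v w) ⟨
      sum (λ x → ind (lookup S x ∧ F v x ∧ F u x))             ≡⟨ triE≡sum S F v u ⟨
      triE S F v u                                             ∎
      where
      open ≤-Reasoning
      σ : Fin n → Fin n
      σ = PC.transpose v w
      move : ∀ x → T (lookup S x ∧ F u x ∧ F w x) → T (lookup S (σ x) ∧ F v (σ x) ∧ F u (σ x))
      move x t = moved (to (commonNbr⇔ {S = S} {F = F}) t) (x ≟ v) (x ≟ w)
        where
        moved : x ∈ S × T (F u x) × T (F w x) → Dec (x ≡ v) → Dec (x ≡ w) →
                T (lookup S (σ x) ∧ F v (σ x) ∧ F u (σ x))
        moved _ (yes refl) _ rewrite transpose-matchˡ v w =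
          let (_ , _ , w∈S) = to (induced⇔ {S}) (F⊆induced I uw)
          in from (commonNbr⇔ {S = S} {F = F}) (w∈S , star I w∈S w≢v , uw)
        moved (_ , _ , wx) (no _) (yes refl) = contradiction (F⊆induced I wx) (induced-irrefl {S})
        moved (x∈S , ux , _) (no x≢v) (no x≢w) rewrite transpose-other x≢v x≢w =
          from (commonNbr⇔ {S = S} {F = F}) (x∈S , star I x∈S x≢v , ux)

    ∈stepE⇔ : ∀ (S : Subset n) (F : EdgeSet n) {u} →
              u ∈ proj₁ (stepE ℓ (S , F)) ⇔ (u ∈ S × ∃[ w ] T (proj₂ (stepE ℓ (S , F)) u w))
    ∈stepE⇔ S F = mk⇔
      (λ t → let (u∈S , has-edge) = to T-∧ (to ∈-tabulate⇔ t)
             in from ∈⇔T-lookup u∈S , to T-any-allFin⇔ has-edge)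
      (λ (u∈S , has-edge) →
         from ∈-tabulate⇔ (from T-∧ (to ∈⇔T-lookup u∈S , from T-any-allFin⇔ has-edge)))

    stepE-edge⇔ : ∀ (S : Subset n) (F : EdgeSet n) {u w} →
                  T (proj₂ (stepE ℓ (S , F)) u w) ⇔ (T (F u w) × ℓ ≤ triE S F u w)
    stepE-edge⇔ S F = mk⇔
      (λ t → let (uw , enough) = to T-∧ t in uw , ≤ᵇ⇒≤ ℓ _ enough)
      (λ (uw , enough) → from T-∧ (uw , ≤⇒≤ᵇ enough))

    stepE-invariant : ∀ {S : Subset n} {F : EdgeSet n} → EdgeInvariant S F →
                      EdgeInvariant (proj₁ (stepE ℓ (S , F))) (proj₂ (stepE ℓ (S , F)))
    stepE-invariant {S} {F} I = record
      { F-sym       = F′-sym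
      ; F⊆induced   = F′⊆induced
      ; ⊆closedNbhd = ⊆closedNbhd I ∘ proj₁ ∘ to (∈stepE⇔ S F)
      ; star        = star′
      }
      where
      F′ : EdgeSet n
      F′ = proj₂ (stepE ℓ (S , F))
      F′-sym : ∀ u w → F′ u w ≡ F′ w u
      F′-sym u w = cong₂ _∧_ (F-sym I u w) (cong (ℓ ≤ᵇ_) (triE-sym S F u w))
      F′⊆induced : ∀ {u w} → T (F′ u w) → T (induced G (proj₁ (stepE ℓ (S , F))) u w)
      F′⊆induced {u} {w} uw =
        let uw₀ = proj₁ (to (stepE-edge⇔ S F {u} {w}) uw)
            (adj-uw , u∈S , w∈S) = to (induced⇔ {S}) (F⊆induced I uw₀)
        in from (induced⇔ {proj₁ (stepE ℓ (S , F))})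
                (adj-uw , from (∈stepE⇔ S F) (u∈S , w , uw)
                        , from (∈stepE⇔ S F) (w∈S , u , subst T (F′-sym u w) uw))
      star′ : ∀ {x} → x ∈ proj₁ (stepE ℓ (S , F)) → x ≢ v → T (F′ v x)
      star′ {x} x∈S′ x≢v with to (∈stepE⇔ S F) x∈S′
      ... | x∈S , w , xw with w ≟ v
      ...   | yes refl = subst T (F′-sym x w) xw
      ...   | no w≢v   =
        let (xw₀ , enough) = to (stepE-edge⇔ S F {x} {w}) xw
        in from (stepE-edge⇔ S F {v} {x})
                (star I x∈S x≢v , ≤-trans enough (triE≤triE-star I xw₀ w≢v))

    initE-invariant : EdgeInvariant (closedNbhd G v) (induced G (closedNbhd G v))
    initE-invariant = record
      { F-sym       = induced-sym (closedNbhd G v)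
      ; F⊆induced   = λ uw → uw
      ; ⊆closedNbhd = λ x∈N → x∈N
      ; star        = λ x∈N x≢v →
          from (induced⇔ {closedNbhd G v}) (closedNbhd⇒adj x∈N x≢v , v∈closedNbhd v , x∈N)
      }

    iterE : ℕ → EState n
    iterE k = iter (stepE ℓ) k (initE G v)

    iterE-invariant : ∀ k → EdgeInvariant (proj₁ (iterE k)) (proj₂ (iterE k))
    iterE-invariant zero    = initE-invariant
    iterE-invariant (suc k) = stepE-invariant (iterE-invariant k)

    size : EState n → ℕ
    size (S , F) = ∣ S ∣ + sum₂ (λ u w → ind (F u w))

    stepE-progress : ∀ s → stepE ℓ s ≈ₛ s ⊎ size (stepE ℓ s) < size s
    stepE-progress (S , F)
      with ⊆⇒≡⊎∣∣< (proj₁ ∘ to (∈stepE⇔ S F))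
         | sum₂-mono-≤⇒≗⊎< (λ u w → ind-mono (proj₁ ∘ to (stepE-edge⇔ S F {u} {w})))
    ... | inj₁ S′≡S | inj₁ F′≗F = inj₁ (S′≡S , λ u w → ind-injective (F′≗F u w))
    ... | inj₁ S′≡S | inj₂ F′<F = inj₂ (+-mono-≤-< (≤-reflexive (cong ∣_∣ S′≡S)) F′<F)
    ... | inj₂ S′<S | _         =
      inj₂ (+-mono-<-≤ S′<S (sum-mono-≤ λ u → sum-mono-≤ λ w →
                               ind-mono (proj₁ ∘ to (stepE-edge⇔ S F {u} {w}))))

    ResultE-exists : Σ (Subset n) (ResultE G ℓ v)
    ResultE-exists =
      let (k , fixed) =
            iter-reaches-fixed (stepE ℓ) (λ s → stepE ℓ s ≈ₛ s) size stepE-progress (initE G v)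
      in proj₁ (iterE k) , k , refl , fixed

    fixed⇒EClub : ∀ {S : Subset n} {F : EdgeSet n} → EdgeInvariant S F →
                  (∀ u w → proj₂ (stepE ℓ (S , F)) u w ≡ F u w) → EClub G ℓ v S
    fixed⇒EClub {S} {F} I fixed =
        ⊆closedNbhd I
      , F , F-sym I , (λ _ _ → F⊆induced I)
      , star⇒diam≤2 v (F-sym I) centre (star I)
      , λ u w uw → proj₂ (to (stepE-edge⇔ S F) (subst T (sym (fixed u w)) uw))
      where
      centre : ∀ {x} → x ∈ S → v ∈ S
      centre {x} x∈S with x ≟ v
      ... | yes refl = x∈S
      ... | no x≢v   = proj₁ (proj₂ (to (induced⇔ {S}) (F⊆induced I (star I x∈S x≢v))))

    stepE-preserves-⊑ : ∀ {X Ê s} → (∀ u w → T (Ê u w) → ℓ ≤ triE X Ê u w) →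
                        (∀ {u} → u ∈ X → ∃[ w ] T (Ê u w)) → (X , Ê) ⊑ s → (X , Ê) ⊑ stepE ℓ s
    stepE-preserves-⊑ {X} {Ê} {S , F} enough no-isolated (X⊆S , Ê⊆F) = X⊆S′ , Ê⊆F′
      where
      Ê⊆F′ : ∀ {p q} → T (Ê p q) → T (proj₂ (stepE ℓ (S , F)) p q)
      Ê⊆F′ {p} {q} pq =
        from (stepE-edge⇔ S F) (Ê⊆F pq , ≤-trans (enough p q pq) (triE-mono-≤ (X⊆S , Ê⊆F) p q))
      X⊆S′ : X ⊆ proj₁ (stepE ℓ (S , F))
      X⊆S′ u∈X = let (w , uw) = no-isolated u∈X in from (∈stepE⇔ S F) (X⊆S u∈X , w , Ê⊆F′ uw)

    EClub⊆iterE : ∀ {X} → EClub G ℓ v X → 2 ≤ ∣ X ∣ → ∀ k → X ⊆ proj₁ (iterE k)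
    EClub⊆iterE {X} (X⊆N , Ê , _ , Ê⊆induced , diam , enough) 2≤∣X∣ = proj₁ ∘ ⊑iterE
      where
      ⊑iterE : ∀ k → (X , Ê) ⊑ iterE k
      ⊑iterE zero    = X⊆N , induced-mono X⊆N ∘ Ê⊆induced _ _
      ⊑iterE (suc k) = stepE-preserves-⊑ enough (diam≤2⇒∃neighbour diam 2≤∣X∣) (⊑iterE k)

    ResultE⇒largest-EClub : ∀ {S} → ResultE G ℓ v S →
      EClub G ℓ v S × (∀ X → EClub G ℓ v X → 2 ≤ ∣ X ∣ → ∣ X ∣ ≤ ∣ S ∣)
    ResultE⇒largest-EClub (k , refl , fixed) =
        fixed⇒EClub (iterE-invariant k) (proj₂ fixed)
      , λ X club 2≤∣X∣ → p⊆q⇒∣p∣≤∣q∣ (EClub⊆iterE club 2≤∣X∣ k)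

proposition4 : ∀ {n} (G : Graph n) (ℓ : ℕ) → 1 ≤ ℓ → (v : Fin n) →
    (Σ (Subset n) (ResultV G ℓ v)
    × (∀ S → ResultV G ℓ v S →
    VClub G ℓ v S × (∀ X → VClub G ℓ v X → ∣ X ∣ ≤ ∣ S ∣)))
    × (Σ (Subset n) (ResultE G ℓ v)
    × (∀ S → ResultE G ℓ v S →
    EClub G ℓ v S × (∀ X → EClub G ℓ v X → 2 ≤ ∣ X ∣ → ∣ X ∣ ≤ ∣ S ∣)))
proposition4 G ℓ _ v =
    (ResultV-exists G ℓ v , λ _ → ResultV⇒largest-VClub G ℓ v)
  , (ResultE-exists G ℓ v , λ _ → ResultE⇒largest-EClub G ℓ v)
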